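{- Let $M$ be a binary matroid with ground set $E$, $w\colon E\to\mathbb{N}_0$, $T\subseteq E$ and $k$ a nonnegative integer. Then $(M,w,T,k)$ is a yes-instance of \textsc{Restricted Subset Feedback Set} if and only if $(M^*,w,T,k)$ is a yes-instance of \textsc{Space Cover}, where $M^*$ is the dual matroid of $M$.
   Context: \textsc{Restricted Subset Feedback Set}: given a binary matroid $M$ with ground set $E$, $w\colon E\to\mathbb{N}_0$, $T\subseteq E$ and a nonnegative integer $k$, decide whether there is $F\subseteq E\setminus T$ with $w(F)\le k$ such that the matroid $M-F$ obtained by deleting $F$ has no circuit containing an element of $T$. \textsc{Space Cover}: given a matroid $M$ on $E$, $w\colon E\to\mathbb{N}_0$, $T\subseteq E$ and $k$, decide whether there is $F\subseteq E\setminus T$ with $w(F)\le k$ and $T\subseteq\mathrm{span}(F)$, where $F$ spans $e$ if $r(F\cup\{e\})=r(F)$ for the rank function $r$. -}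

module Defs where

open import Data.Nat using (ℕ; zero; suc; _+_; _≤_)
open import Data.Bool using (Bool; true; false; _∧_; _xor_)
open import Data.Fin using (Fin)
open import Data.Fin.Subset using (Subset; _∈_; _∉_; _⊆_; _⊂_; ∁; _∪_; ⁅_⁆; ∣_∣; Nonempty)
open import Data.Vec using (Vec; []; _∷_; lookup)
open import Data.Product using (Σ; _×_; ∃)
open import Relation.Nullary using (¬_)
open import Relation.Binary.PropositionalEquality using (_≡_)

weight : ∀ {n} → (Fin n → ℕ) → Subset n → ℕ
weight {zero}  w []          = 0
weight {suc n} w (true  ∷ F) = w Fin.zero + weight (λ j → w (Fin.suc j)) F
weight {suc n} w (false ∷ F) = weight (λ j → w (Fin.suc j)) F

-- Matroids on the ground set Fin n, given by independence predicates,
-- with an explicit ground set G ⊆ Fin n (needed for deletion).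

IndepPred : ℕ → Set₁
IndepPred n = Subset n → Set

IsBasis : ∀ {n} → IndepPred n → Subset n → Subset n → Set
IsBasis Indep G B = B ⊆ G × Indep B × (∀ J → J ⊆ G → Indep J → B ⊆ J → J ⊆ B)

IsCircuit : ∀ {n} → IndepPred n → Subset n → Subset n → Set
IsCircuit Indep G C = C ⊆ G × ¬ Indep C × (∀ D → D ⊂ C → Indep D)

IsRank : ∀ {n} → IndepPred n → Subset n → ℕ → Set
IsRank Indep X r =
  (Σ (Subset _) λ I → I ⊆ X × Indep I × ∣ I ∣ ≡ r)
  × (∀ J → J ⊆ X → Indep J → ∣ J ∣ ≤ r)

Spans : ∀ {n} → IndepPred n → Subset n → Fin n → Set
Spans Indep F e = ∀ r → IsRank Indep F r → IsRank Indep (F ∪ ⁅ e ⁆) r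

-- Dual matroid (ground set all of Fin n): I is independent in M* iff
-- I is contained in the complement of some basis of M
-- (equivalently, bases of M* are complements of bases of M).
fullSet : ∀ {n} → Subset n
fullSet {zero} = []
fullSet {suc n} = true ∷ fullSet

Dual : ∀ {n} → IndepPred n → IndepPred n
Dual Indep I = Σ (Subset _) λ B → IsBasis Indep fullSet B × I ⊆ ∁ B

-- Binary matroids: the column matroid of an m × n matrix over GF(2)
-- (Bool with xor as addition, ∧ as multiplication).

BinMatrix : ℕ → ℕ → Set
BinMatrix m n = Fin m → Fin n → Bool

colSumRow : ∀ {n} → (Fin n → Bool) → Subset n → Bool
colSumRow {zero}  row []      = false
colSumRow {suc n} row (b ∷ Y) = (b ∧ row Fin.zero) xor colSumRow (λ j → row (Fin.suc j)) Y

ZeroSum : ∀ {m n} → BinMatrix m n → Subset n → Set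
ZeroSum A Y = ∀ i → colSumRow (A i) Y ≡ false

-- columns in X are linearly independent over GF(2): no nonempty
-- subset of them sums to zero (over GF(2) coefficients are 0/1).
BinIndep : ∀ {m n} → BinMatrix m n → IndepPred n
BinIndep A X = ∀ Y → Y ⊆ X → Nonempty Y → ¬ ZeroSum A Y

RSFS-yes : ∀ {n} → IndepPred n → (Fin n → ℕ) → Subset n → ℕ → Set
RSFS-yes {n} Indep w T k = Σ (Subset n) λ F →
  F ⊆ ∁ T × weight w F ≤ k ×
  (∀ C → IsCircuit Indep (∁ F) C → ∀ t → t ∈ T → t ∉ C)

SpaceCover-yes : ∀ {n} → IndepPred n → (Fin n → ℕ) → Subset n → ℕ → Set
SpaceCover-yes {n} Indep w T k = Σ (Subset n) λ F →
  F ⊆ ∁ T × weight w F ≤ k × (∀ t → t ∈ T → Spans Indep F t)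

module Submission where

-- Restricted Subset Feedback Set in a binary matroid M is Space Cover in
-- the dual matroid M*: for F ⊆ E ∖ T, the deletion M − F has no circuit
-- through t ∈ T iff t is spanned by F in M*.
--
-- M is the column matroid of a GF(2)-matrix A, so a set is dependent iff
-- it has a nonempty subset whose columns sum to zero, and zero-sum sets
-- are closed under symmetric difference (linearity of column sums).
--
-- (⇒) If t ∈ J ⊆ F ∪ {t} is co-independent (J ⊆ E ∖ B), the fundamental
-- circuit of t avoids F only if M − F has a circuit through t; otherwise it
-- meets F in some f ∈ B, and swapping t for f in J and f for t in B gives a
-- co-independent subset of F at least as large as J.
-- (⇐) If a circuit of M − F passes through t, the pivot lemma exchanges t
-- out of the basis complementary to a maximum co-independent I ⊆ F, so
-- I ∪ {t} is co-independent, contradicting that F spans t in M*.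

open import Defs
open import Data.Nat using (ℕ; suc; s≤s; _≤_; _<_; _∸_; _≤?_)
open import Data.Nat.Induction using (<-wellFounded)
open import Data.Nat.Properties using (≤-trans; ≤-refl; ≮⇒≥; <⇒≱; n≤1+n; ∸-monoʳ-<)
open import Data.Bool using (Bool; true; false; _∧_; _xor_)
open import Data.Bool.Properties using (∧-distribʳ-xor; xor-∧-commutativeRing) renaming (_≟_ to _≟ᵇ_)
open import Algebra.Bundles using (CommutativeRing)
open import Algebra.Properties.CommutativeSemigroup (CommutativeRing.+-commutativeSemigroup xor-∧-commutativeRing) using (interchange)
open import Data.Fin using (Fin; zero; suc; _≟_)
open import Data.Fin.Properties using (all?)
open import Data.Fin.Subset using (Subset; _∈_; _∉_; _⊆_; _⊂_; ∁; _∪_; _∩_; _─_; _-_; ⁅_⁆; ∣_∣; Nonempty) renaming (⊥ to ∅)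
open import Data.Fin.Subset.Properties using (_∈?_; _⊆?_; _⊂?_; nonempty?; anySubset?; ∣p∣≤n; x∈⁅x⁆; x∈⁅y⁆⇒x≡y; x∉⁅y⁆⇒x≢y; ⊆-trans; ⊥⊆; p⊆q⇒∣p∣≤∣q∣; p⊂q⇒p⊆q; p⊂q⇒∣p∣<∣q∣; x∈∁p⇒x∉p; x∉p⇒x∈∁p; x∈p∩q⁺; x∈p∩q⁻; p⊆p∪q; x∈p∪q⁻; x∈p∪q⁺; p─q⊆p; x∈p∧x≢y⇒x∈p-y; ∪-identityʳ) renaming (∉⊥ to ∉∅)
open import Data.Fin.Subset.Induction using (⊂-wellFounded; Acc; acc)
open import Data.Vec using ([]; _∷_; here; there; zipWith)
open import Data.Product using (Σ; _×_; _,_; proj₁; proj₂)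
open import Data.Sum using (_⊎_; inj₁; inj₂; [_,_]′)
import Data.Sum as Sum
open import Data.Empty using (⊥; ⊥-elim)
open import Function using (_∘_)
open import Relation.Nullary using (¬_; Dec; yes; no)
open import Relation.Nullary.Decidable using (_×-dec_; ¬?; map′; decidable-stable)
open import Relation.Binary.PropositionalEquality using (_≡_; refl; trans; cong₂; _≢_)
open import Function.Bundles using (_⇔_; mk⇔)

private
  variable
    n : ℕ
    p q B C F I X Y : Subset n
    t x y z : Fin n

∈∪⁅⁆⁻ : z ∈ p ∪ ⁅ x ⁆ → z ∈ p ⊎ z ≡ x
∈∪⁅⁆⁻ {p = p} {x = x} h = Sum.map₂ (x∈⁅y⁆⇒x≡y x) (x∈p∪q⁻ p ⁅ x ⁆ h)

∈∪⁅⁆ˡ : z ∈ p → z ∈ p ∪ ⁅ x ⁆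
∈∪⁅⁆ˡ {x = x} = p⊆p∪q ⁅ x ⁆

∈∪⁅⁆ʳ : x ∈ p ∪ ⁅ x ⁆
∈∪⁅⁆ʳ {x = x} {p = p} = x∈p∪q⁺ {p = p} (inj₂ (x∈⁅x⁆ x))

∈∪⁅⁆⁺ : (z ≢ x → z ∈ p) → z ∈ p ∪ ⁅ x ⁆
∈∪⁅⁆⁺ {z = z} {x = x} h with z ≟ x
... | yes refl = ∈∪⁅⁆ʳ
... | no z≢x = ∈∪⁅⁆ˡ (h z≢x)

∈∪⁅⁆-≢ : z ∈ p ∪ ⁅ x ⁆ → z ≢ x → z ∈ p
∈∪⁅⁆-≢ h z≢x = [ (λ z∈p → z∈p) , (λ z≡x → ⊥-elim (z≢x z≡x)) ]′ (∈∪⁅⁆⁻ h)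

⊆∪⁅⁆-avoiding : X ⊆ p ∪ ⁅ x ⁆ → x ∉ X → X ⊆ p
⊆∪⁅⁆-avoiding X⊆ x∉X z∈X = ∈∪⁅⁆-≢ (X⊆ z∈X) (λ { refl → x∉X z∈X })

∪⁅⁆-⊆ : X ⊆ Y → x ∈ Y → X ∪ ⁅ x ⁆ ⊆ Y
∪⁅⁆-⊆ X⊆Y x∈Y h = [ X⊆Y , (λ { refl → x∈Y }) ]′ (∈∪⁅⁆⁻ h)

∈─⇒∉ : ∀ (p q : Subset n) → z ∈ p ─ q → z ∉ q
∈─⇒∉ (_ ∷ p) (_ ∷ q) (there h) (there k) = ∈─⇒∉ p q h k
∈─⇒∉ (_ ∷ p) (true ∷ q) () here

∈-⁻ : z ∈ p - y → z ∈ p × z ≢ y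
∈-⁻ {p = p} {y = y} h = p─q⊆p p ⁅ y ⁆ h , x∉⁅y⁆⇒x≢y (∈─⇒∉ p ⁅ y ⁆ h)

∣p∪⁅x⁆∣≤1+∣p∣ : ∀ (p : Subset n) x → ∣ p ∪ ⁅ x ⁆ ∣ ≤ suc ∣ p ∣
∣p∪⁅x⁆∣≤1+∣p∣ (true  ∷ p) zero    rewrite ∪-identityʳ p = s≤s (n≤1+n _)
∣p∪⁅x⁆∣≤1+∣p∣ (false ∷ p) zero    rewrite ∪-identityʳ p = ≤-refl
∣p∪⁅x⁆∣≤1+∣p∣ (true  ∷ p) (suc x) = s≤s (∣p∪⁅x⁆∣≤1+∣p∣ p x)
∣p∪⁅x⁆∣≤1+∣p∣ (false ∷ p) (suc x) = ∣p∪⁅x⁆∣≤1+∣p∣ p x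

⊆fullSet : p ⊆ fullSet
⊆fullSet {x = x} _ = full x
  where
  full : ∀ {n} (x : Fin n) → x ∈ fullSet
  full zero    = here
  full (suc x) = there (full x)

_[_↦_] : Subset n → Fin n → Fin n → Subset n
p [ y ↦ x ] = (p - y) ∪ ⁅ x ⁆

∈[↦]⁻ : z ∈ p [ y ↦ x ] → (z ∈ p × z ≢ y) ⊎ z ≡ x
∈[↦]⁻ = Sum.map₁ ∈-⁻ ∘ ∈∪⁅⁆⁻

∈[↦]⁺ : z ∈ p → z ≢ y → z ∈ p [ y ↦ x ]
∈[↦]⁺ z∈p z≢y = ∈∪⁅⁆ˡ (x∈p∧x≢y⇒x∈p-y z∈p z≢y)

x∈[↦] : x ∈ p [ y ↦ x ]
x∈[↦] = ∈∪⁅⁆ʳ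

[↦]-cover : p ⊆ p [ y ↦ x ] ∪ ⁅ y ⁆
[↦]-cover z∈p = ∈∪⁅⁆⁺ (∈[↦]⁺ z∈p)

∉[↦] : z ∉ p → z ≢ x → z ∉ p [ y ↦ x ]
∉[↦] z∉p z≢x h = [ (λ (z∈p , _) → z∉p z∈p) , z≢x ]′ (∈[↦]⁻ h)

y∉[↦] : y ∈ p → x ∉ p → y ∉ p [ y ↦ x ]
y∉[↦] y∈p x∉p h = [ (λ (_ , y≢y) → y≢y refl) , (λ { refl → x∉p y∈p }) ]′ (∈[↦]⁻ h)

⊆∁[↦] : X ⊆ ∁ p → x ∉ X → X ⊆ ∁ (p [ y ↦ x ])
⊆∁[↦] X⊆∁p x∉X z∈X =
  x∉p⇒x∈∁p (∉[↦] (x∈∁p⇒x∉p (X⊆∁p z∈X)) (λ { refl → x∉X z∈X }))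

∣p∣≤∣p[↦]∣ : ∀ (p : Subset n) → x ∉ p → ∣ p ∣ ≤ ∣ p [ y ↦ x ] ∣
∣p∣≤∣p[↦]∣ {x = x} {y = y} p x∉p = ≤-trans (p⊆q⇒∣p∣≤∣q∣ split)
  (≤-trans (∣p∪⁅x⁆∣≤1+∣p∣ (p - y) y) (p⊂q⇒∣p∣<∣q∣ grow))
  where
  split : p ⊆ (p - y) ∪ ⁅ y ⁆
  split z∈p = ∈∪⁅⁆⁺ (x∈p∧x≢y⇒x∈p-y z∈p)
  grow : p - y ⊂ p [ y ↦ x ]
  grow = p⊆p∪q ⁅ x ⁆ , x , x∈[↦] , λ x∈p-y → x∉p (proj₁ (∈-⁻ x∈p-y))

_⊕_ : Subset n → Subset n → Subset n
p ⊕ q = zipWith _xor_ p q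

∈⊕⁻ : ∀ (p q : Subset n) → z ∈ p ⊕ q → (z ∈ p × z ∉ q) ⊎ (z ∉ p × z ∈ q)
∈⊕⁻ (true  ∷ p) (false ∷ q) here = inj₁ (here , λ ())
∈⊕⁻ (false ∷ p) (true  ∷ q) here = inj₂ ((λ ()) , here)
∈⊕⁻ (_ ∷ p) (_ ∷ q) (there h) with ∈⊕⁻ p q h
... | inj₁ (z∈p , z∉q) = inj₁ (there z∈p , λ { (there k) → z∉q k })
... | inj₂ (z∉p , z∈q) = inj₂ ((λ { (there k) → z∉p k }) , there z∈q)

∈⊕⁺ : (z ∈ p × z ∉ q) ⊎ (z ∉ p × z ∈ q) → z ∈ p ⊕ q
∈⊕⁺ {q = false ∷ _} (inj₁ (here , _)) = here
∈⊕⁺ {q = true ∷ _} (inj₁ (here , z∉q)) = ⊥-elim (z∉q here)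
∈⊕⁺ {q = _ ∷ _} (inj₁ (there z∈p , z∉q)) = there (∈⊕⁺ (inj₁ (z∈p , z∉q ∘ there)))
∈⊕⁺ {p = false ∷ _} (inj₂ (_ , here)) = here
∈⊕⁺ {p = true ∷ _} (inj₂ (z∉p , here)) = ⊥-elim (z∉p here)
∈⊕⁺ {p = _ ∷ _} (inj₂ (z∉p , there z∈q)) = there (∈⊕⁺ (inj₂ (z∉p ∘ there , z∈q)))

∉⊕ : z ∈ p → z ∈ q → z ∉ p ⊕ q
∉⊕ {p = p} {q = q} z∈p z∈q h = [ (λ (_ , z∉q) → z∉q z∈q) , (λ (z∉p , _) → z∉p z∈p) ]′ (∈⊕⁻ p q h)

⊕-eliminates : X ⊆ p ∪ ⁅ x ⁆ → Y ⊆ p ∪ ⁅ x ⁆ → x ∈ X → x ∈ Y → X ⊕ Y ⊆ p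
⊕-eliminates {X = X} {Y = Y} X⊆ Y⊆ x∈X x∈Y h with ∈⊕⁻ X Y h
... | inj₁ (z∈X , z∉Y) = ∈∪⁅⁆-≢ (X⊆ z∈X) (λ { refl → z∉Y x∈Y })
... | inj₂ (z∉X , z∈Y) = ∈∪⁅⁆-≢ (Y⊆ z∈Y) (λ { refl → z∉X x∈X })

⊕-⊆ˡ : Y ⊆ X → X ⊕ Y ⊆ X
⊕-⊆ˡ {Y = Y} {X = X} Y⊆X h = [ proj₁ , (λ (z∉X , z∈Y) → ⊥-elim (z∉X (Y⊆X z∈Y))) ]′ (∈⊕⁻ X Y h)

⊕-shrinks-outside : C ⊆ p ∪ ⁅ x ⁆ → x ∈ X → x ∈ C → x ∉ p → (X ⊕ C) ∩ ∁ p ⊂ X ∩ ∁ p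
⊕-shrinks-outside {C = C} {p = p} {x = x} {X = X} C⊆ x∈X x∈C x∉p =
  shrunk , x , x∈p∩q⁺ (x∈X , x∉p⇒x∈∁p x∉p) , λ h → ∉⊕ x∈X x∈C (proj₁ (x∈p∩q⁻ _ _ h))
  where
  shrunk : (X ⊕ C) ∩ ∁ p ⊆ X ∩ ∁ p
  shrunk h with x∈p∩q⁻ (X ⊕ C) (∁ p) h
  ... | z∈X⊕C , z∈∁p with ∈⊕⁻ X C z∈X⊕C
  ...   | inj₁ (z∈X , _) = x∈p∩q⁺ (z∈X , z∈∁p)
  ...   | inj₂ (z∉X , z∈C) =
    [ (λ z∈p → ⊥-elim (x∈∁p⇒x∉p z∈∁p z∈p)) , (λ { refl → ⊥-elim (z∉X x∈X) }) ]′ (∈∪⁅⁆⁻ (C⊆ z∈C))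

colSumRow-⊕ : ∀ (row : Fin n → Bool) (Y Z : Subset n) →
  colSumRow row (Y ⊕ Z) ≡ (colSumRow row Y xor colSumRow row Z)
colSumRow-⊕ row [] [] = refl
colSumRow-⊕ row (b ∷ Y) (c ∷ Z) =
  trans (cong₂ _xor_ (∧-distribʳ-xor (row zero) b c) (colSumRow-⊕ (row ∘ suc) Y Z))
        (interchange (b ∧ row zero) (c ∧ row zero) _ _)

maximum : ∀ {P : Subset n → Set} → (∀ X → Dec (P X)) → ∀ X → P X →
  Σ (Subset n) λ Y → P Y × (∀ Z → P Z → ∣ Z ∣ ≤ ∣ Y ∣)
maximum {n} {P} P? X₀ pX₀ = climb X₀ (<-wellFounded (n ∸ ∣ X₀ ∣)) pX₀
  where
  climb : ∀ X → Acc _<_ (n ∸ ∣ X ∣) → P X → Σ (Subset n) λ Y → P Y × (∀ Z → P Z → ∣ Z ∣ ≤ ∣ Y ∣)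
  climb X (acc larger) pX with anySubset? (λ Z → P? Z ×-dec (suc ∣ X ∣ ≤? ∣ Z ∣))
  ... | yes (Z , pZ , ∣X∣<∣Z∣) = climb Z (larger (∸-monoʳ-< ∣X∣<∣Z∣ (∣p∣≤n Z))) pZ
  ... | no none = X , pX , λ Z pZ → ≮⇒≥ (λ ∣X∣<∣Z∣ → none (Z , pZ , ∣X∣<∣Z∣))

module BinaryMatroid {m n : ℕ} (A : BinMatrix m n) where

  Ind : IndepPred n
  Ind = BinIndep A

  Basis : Subset n → Set
  Basis B = IsBasis Ind fullSet B

  Ind* : IndepPred n
  Ind* = Dual Ind

  zeroSum-⊕ : ZeroSum A X → ZeroSum A Y → ZeroSum A (X ⊕ Y)
  zeroSum-⊕ {X = X} {Y = Y} zX zY i = trans (colSumRow-⊕ (A i) X Y) (cong₂ _xor_ (zX i) (zY i))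

  zeroSum? : ∀ X → Dec (ZeroSum A X)
  zeroSum? X = all? (λ i → colSumRow (A i) X ≟ᵇ false)

  Dependence : Subset n → Set
  Dependence X = Σ (Subset n) λ Y → Y ⊆ X × Nonempty Y × ZeroSum A Y

  dependence? : ∀ X → Dec (Dependence X)
  dependence? X = anySubset? (λ Y → (Y ⊆? X) ×-dec (nonempty? Y ×-dec zeroSum? Y))

  no-dependence⇒independent : ¬ Dependence X → Ind X
  no-dependence⇒independent none Y Y⊆X neY zY = none (Y , Y⊆X , neY , zY)

  independent? : ∀ X → Dec (Ind X)
  independent? X = map′ no-dependence⇒independent
    (λ ind (Y , Y⊆X , neY , zY) → ind Y Y⊆X neY zY) (¬? (dependence? X))

  dependence : ¬ Ind X → Dependence X
  dependence {X = X} dep = decidable-stable (dependence? X) (dep ∘ no-dependence⇒independent)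

  InSpan : Subset n → Fin n → Set
  InSpan S z = Σ (Subset n) λ C → C ⊆ S ∪ ⁅ z ⁆ × ZeroSum A C × z ∈ C

  inSpan-of-dependent : Ind B → ¬ Ind (B ∪ ⁅ z ⁆) → InSpan B z
  inSpan-of-dependent {z = z} indB dep with dependence dep
  ... | Y , Y⊆ , neY , zY with z ∈? Y
  ...   | yes z∈Y = Y , Y⊆ , zY , z∈Y
  ...   | no z∉Y = ⊥-elim (indB Y (⊆∪⁅⁆-avoiding Y⊆ z∉Y) neY zY)

  inSpan-excluded : InSpan B z → B ⊆ I → z ∈ I → ¬ Ind I
  inSpan-excluded (C , C⊆ , zC , z∈C) B⊆I z∈I indI =
    indI C (λ h → ∪⁅⁆-⊆ B⊆I z∈I (C⊆ h)) (_ , z∈C) zC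

  fundamental : Basis B → z ∉ B → InSpan B z
  fundamental (_ , indB , maximal) z∉B = inSpan-of-dependent indB
    (λ ind → z∉B (maximal _ ⊆fullSet ind (p⊆p∪q _) ∈∪⁅⁆ʳ))

  basis-intro : Ind B → (∀ z → z ∉ B → InSpan B z) → Basis B
  basis-intro {B = B} indB spans = ⊆fullSet , indB , λ I _ indI B⊆I {z} z∈I →
    decidable-stable (z ∈? B) (λ z∉B → inSpan-excluded (spans z z∉B) B⊆I z∈I indI)

  -- An independent set of maximum size is a basis.
  basis-exists : Σ (Subset n) Basis
  basis-exists with maximum independent? ∅ (λ Y Y⊆∅ (v , v∈Y) _ → ∉∅ (Y⊆∅ v∈Y))
  ... | B , indB , largest = B , basis-intro indB λ z z∉B → inSpan-of-dependent indB
    λ ind → <⇒≱ (p⊂q⇒∣p∣<∣q∣ (p⊆p∪q _ , z , ∈∪⁅⁆ʳ , z∉B)) (largest _ ind)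

  basis? : ∀ B → Dec (Basis B)
  basis? B with independent? B | anySubset? (λ I → (B ⊆? I) ×-dec (independent? I ×-dec ¬? (I ⊆? B)))
  ... | no dep | _ = no (λ (_ , indB , _) → dep indB)
  ... | yes _ | yes (I , B⊆I , indI , I⊈B) = no (λ (_ , _ , maximal) → I⊈B (maximal I ⊆fullSet indI B⊆I))
  ... | yes indB | no none = yes (⊆fullSet , indB , λ I _ indI B⊆I →
    decidable-stable (I ⊆? B) (λ I⊈B → none (I , B⊆I , indI , I⊈B)))

  independent*? : ∀ I → Dec (Ind* I)
  independent*? I = anySubset? (λ B → basis? B ×-dec (I ⊆? ∁ B))

  rank* : ∀ X → Σ ℕ (IsRank Ind* X)
  rank* X with maximum (λ I → (I ⊆? X) ×-dec independent*? I) ∅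
                 (⊥⊆ , proj₁ basis-exists , proj₂ basis-exists , ⊥⊆)
  ... | I , (I⊆X , ind*I) , largest = ∣ I ∣ , (I , I⊆X , ind*I , refl) , λ J J⊆X ind*J → largest J (J⊆X , ind*J)

  exchange : Basis B → x ∉ B → (span : InSpan B x) → y ∈ proj₁ span → y ∈ B → Basis (B [ y ↦ x ])
  exchange {B = B} {x = x} {y = y} basB@(_ , indB , _) x∉B (C , C⊆ , zC , x∈C) y∈C y∈B =
    basis-intro independent spanning
    where
    B' : Subset _
    B' = B [ y ↦ x ]

    B'⊆ : B' ⊆ B ∪ ⁅ x ⁆
    B'⊆ h = [ (λ (z∈B , _) → ∈∪⁅⁆ˡ z∈B) , (λ { refl → ∈∪⁅⁆ʳ }) ]′ (∈[↦]⁻ h)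

    -- a zero-sum Y ⊆ B' either avoids x (so Y ⊆ B) or, summed with C,
    -- gives a zero-sum subset of B containing y
    independent : Ind B'
    independent Y Y⊆B' neY zY with x ∈? Y
    ... | no x∉Y = indB Y (⊆∪⁅⁆-avoiding (λ h → B'⊆ (Y⊆B' h)) x∉Y) neY zY
    ... | yes x∈Y = indB (Y ⊕ C) (⊕-eliminates (λ h → B'⊆ (Y⊆B' h)) C⊆ x∈Y x∈C)
      (y , ∈⊕⁺ (inj₂ ((λ y∈Y → y∉[↦] y∈B x∉B (Y⊆B' y∈Y)) , y∈C))) (zeroSum-⊕ zY zC)

    -- y is spanned by C; any other z ∉ B' is spanned by its fundamental
    -- circuit D, from which y is eliminated using C if necessary
    spanning : ∀ z → z ∉ B' → InSpan B' z
    spanning z z∉B' with z ≟ y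
    ... | yes refl = C , (λ h → ∪⁅⁆-⊆ [↦]-cover (∈∪⁅⁆ˡ x∈[↦]) (C⊆ h)) , zC , y∈C
    ... | no z≢y with fundamental basB (λ z∈B → z∉B' (∈[↦]⁺ z∈B z≢y))
    ...   | D , D⊆ , zD , z∈D = result (y ∈? D)
      where
      B⊆ : B ⊆ (B' ∪ ⁅ z ⁆) ∪ ⁅ y ⁆
      B⊆ h = ∪⁅⁆-⊆ (λ h' → ∈∪⁅⁆ˡ (∈∪⁅⁆ˡ h')) ∈∪⁅⁆ʳ ([↦]-cover h)

      D⊆' : D ⊆ (B' ∪ ⁅ z ⁆) ∪ ⁅ y ⁆
      D⊆' h = ∪⁅⁆-⊆ B⊆ (∈∪⁅⁆ˡ ∈∪⁅⁆ʳ) (D⊆ h)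

      C⊆' : C ⊆ (B' ∪ ⁅ z ⁆) ∪ ⁅ y ⁆
      C⊆' h = ∪⁅⁆-⊆ B⊆ (∈∪⁅⁆ˡ (∈∪⁅⁆ˡ x∈[↦])) (C⊆ h)

      z∉C : z ∉ C
      z∉C h = [ (λ z∈B → z∉B' (∈[↦]⁺ z∈B z≢y)) , (λ { refl → z∉B' x∈[↦] }) ]′ (∈∪⁅⁆⁻ (C⊆ h))

      result : Dec (y ∈ D) → InSpan B' z
      result (no y∉D) = D , ⊆∪⁅⁆-avoiding D⊆' y∉D , zD , z∈D
      result (yes y∈D) = D ⊕ C , ⊕-eliminates D⊆' C⊆' y∈D y∈C , zeroSum-⊕ zD zC , ∈⊕⁺ (inj₁ (z∈D , z∉C))

  -- A zero-sum set D ⊆ G through t contains a circuit of (G, Ind) through t,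
  -- namely a ⊂-minimal zero-sum subset of D containing t.
  circuit-within : ∀ {G} D → D ⊆ G → ZeroSum A D → t ∈ D → Σ (Subset n) λ C → IsCircuit Ind G C × t ∈ C
  circuit-within {t = t} {G = G} D = shrink D (⊂-wellFounded D)
    where
    shrink : ∀ D → Acc _⊂_ D → D ⊆ G → ZeroSum A D → t ∈ D → Σ (Subset n) λ C → IsCircuit Ind G C × t ∈ C
    shrink D (acc smaller) D⊆G zD t∈D with anySubset? (λ E → (E ⊂? D) ×-dec (zeroSum? E ×-dec (t ∈? E)))
    ... | yes (E , E⊂D , zE , t∈E) = shrink E (smaller E⊂D) (⊆-trans (p⊂q⇒p⊆q E⊂D) D⊆G) zE t∈E
    ... | no none = D , (D⊆G , (λ ind → ind D (λ h → h) (t , t∈D) zD) , minimal) , t∈D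
      where
      -- a zero-sum Y inside a proper subset Z of D either contains t, or
      -- D ⊕ Y is a smaller zero-sum set through t; both contradict minimality
      minimal : ∀ Z → Z ⊂ D → Ind Z
      minimal Z (Z⊆D , u , u∈D , u∉Z) Y Y⊆Z (v , v∈Y) zY with t ∈? Y
      ... | yes t∈Y = none (Y , ((λ h → Z⊆D (Y⊆Z h)) , u , u∈D , (λ u∈Y → u∉Z (Y⊆Z u∈Y))) , zY , t∈Y)
      ... | no t∉Y = none (D ⊕ Y , (⊕-⊆ˡ (λ h → Z⊆D (Y⊆Z h)) , v , Z⊆D (Y⊆Z v∈Y) , ∉⊕ (Z⊆D (Y⊆Z v∈Y)) v∈Y)
                          , zeroSum-⊕ zD zY , ∈⊕⁺ (inj₁ (t∈D , t∉Y)))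

  circuit-zeroSum : ∀ {G} → IsCircuit Ind G C → t ∈ C → Σ (Subset n) λ Y → Y ⊆ C × ZeroSum A Y × t ∈ Y
  circuit-zeroSum {t = t} (_ , dep , minimal) t∈C with dependence dep
  ... | Y , Y⊆C , neY , zY with t ∈? Y
  ...   | yes t∈Y = Y , Y⊆C , zY , t∈Y
  ...   | no t∉Y = ⊥-elim (minimal Y (Y⊆C , t , t∈C , t∉Y) Y (λ h → h) neY zY)

  Pivot : Subset n → Fin n → Subset n → Set
  Pivot B t D = Σ (Fin n) λ g → g ∈ D × g ∉ B × Σ (InSpan B g) λ span → t ∈ proj₁ span

  pivot-mono : ∀ {D E} → E ∩ ∁ B ⊆ D ∩ ∁ B → Pivot B t E → Pivot B t D
  pivot-mono {B = B} {D = D} {E = E} sub (g , g∈E , g∉B , found) =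
    g , proj₁ (x∈p∩q⁻ D (∁ B) (sub (x∈p∩q⁺ (g∈E , x∉p⇒x∈∁p g∉B)))) , g∉B , found

  -- For t in a basis B, every zero-sum D through t has a pivot; otherwise
  -- adding the fundamental circuits of D ∖ B to D one by one would leave a
  -- zero-sum subset of B containing t.
  pivot : Basis B → t ∈ B → ∀ D → ZeroSum A D → t ∈ D → Pivot B t D
  pivot {B = B} {t = t} basB@(_ , indB , _) t∈B D = search D (⊂-wellFounded (D ∩ ∁ B))
    where
    search : ∀ D → Acc _⊂_ (D ∩ ∁ B) → ZeroSum A D → t ∈ D → Pivot B t D
    search D (acc smaller) zD t∈D with nonempty? (D ∩ ∁ B)
    ... | no inside = ⊥-elim (indB D D⊆B (t , t∈D) zD)
      where
      D⊆B : D ⊆ B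
      D⊆B {e} e∈D = decidable-stable (e ∈? B) (λ e∉B → inside (e , x∈p∩q⁺ (e∈D , x∉p⇒x∈∁p e∉B)))
    ... | yes (g , g∈D∖B) = try (fundamental basB g∉B)
      where
      g∈D : g ∈ D
      g∈D = proj₁ (x∈p∩q⁻ D (∁ B) g∈D∖B)
      g∉B : g ∉ B
      g∉B = x∈∁p⇒x∉p (proj₂ (x∈p∩q⁻ D (∁ B) g∈D∖B))

      try : InSpan B g → Pivot B t D
      try span@(C , C⊆ , zC , g∈C) with t ∈? C
      ... | yes t∈C = g , g∈D , g∉B , span , t∈C
      ... | no t∉C = pivot-mono (proj₁ shrinks)
        (search (D ⊕ C) (smaller shrinks) (zeroSum-⊕ zD zC) (∈⊕⁺ (inj₁ (t∈D , t∉C))))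
        where
        shrinks : (D ⊕ C) ∩ ∁ B ⊂ D ∩ ∁ B
        shrinks = ⊕-shrinks-outside C⊆ g∈D g∈C g∉B

  -- Swapping t ∈ J for an element f ∈ B of the fundamental circuit of t
  -- keeps a set J ⊆ ∁ B co-independent: it avoids the basis B [ f ↦ t ].
  coindependent-swap : ∀ {J f} → Basis B → J ⊆ ∁ B → t ∈ J →
    (span : InSpan B t) → f ∈ proj₁ span → f ∈ B → Ind* (J [ t ↦ f ])
  coindependent-swap {B = B} {t = t} {J = J} {f = f} basB J⊆∁B t∈J span f∈C f∈B =
    B [ f ↦ t ] , exchange basB t∉B span f∈C f∈B ,
    ∪⁅⁆-⊆ (⊆∁[↦] (λ h → J⊆∁B (proj₁ (∈-⁻ h))) (λ t∈J-t → proj₂ (∈-⁻ t∈J-t) refl))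
          (x∉p⇒x∈∁p (y∉[↦] f∈B t∉B))
    where
    t∉B : t ∉ B
    t∉B = x∈∁p⇒x∉p (J⊆∁B t∈J)

  spans-of-no-circuit : t ∉ F → (∀ C → IsCircuit Ind (∁ F) C → t ∉ C) → Spans Ind* F t
  spans-of-no-circuit {t = t} {F = F} t∉F noCircuit r ((I , I⊆F , ind*I , ∣I∣≡r) , bound) =
    (I , (λ h → ∈∪⁅⁆ˡ (I⊆F h)) , ind*I , ∣I∣≡r) , bound'
    where
    bound' : ∀ J → J ⊆ F ∪ ⁅ t ⁆ → Ind* J → ∣ J ∣ ≤ r
    bound' J J⊆ (B , basB , J⊆∁B) with t ∈? J
    ... | no t∉J = bound J (⊆∪⁅⁆-avoiding J⊆ t∉J) (B , basB , J⊆∁B)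
    ... | yes t∈J = via (fundamental basB (x∈∁p⇒x∉p (J⊆∁B t∈J)))
      where
      -- the fundamental circuit C of t must meet F, in some f ∈ B, and
      -- then J [ t ↦ f ] ⊆ F is co-independent and at least as large as J
      via : InSpan B t → ∣ J ∣ ≤ r
      via span@(C , C⊆ , zC , t∈C) with nonempty? (C ∩ F)
      ... | no avoids = ⊥-elim (excluded (circuit-within C C⊆∁F zC t∈C))
        where
        C⊆∁F : C ⊆ ∁ F
        C⊆∁F e∈C = x∉p⇒x∈∁p (λ e∈F → avoids (_ , x∈p∩q⁺ (e∈C , e∈F)))
        excluded : Σ (Subset _) (λ C' → IsCircuit Ind (∁ F) C' × t ∈ C') → ⊥
        excluded (C' , circ , t∈C') = noCircuit C' circ t∈C'
      ... | yes (f , f∈C∩F) = ≤-trans (∣p∣≤∣p[↦]∣ J f∉J)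
        (bound (J [ t ↦ f ]) J'⊆F (coindependent-swap basB J⊆∁B t∈J span f∈C f∈B))
        where
        f∈C : f ∈ C
        f∈C = proj₁ (x∈p∩q⁻ C F f∈C∩F)
        f∈F : f ∈ F
        f∈F = proj₂ (x∈p∩q⁻ C F f∈C∩F)
        f∈B : f ∈ B
        f∈B = ∈∪⁅⁆-≢ (C⊆ f∈C) (λ { refl → t∉F f∈F })
        f∉J : f ∉ J
        f∉J f∈J = x∈∁p⇒x∉p (J⊆∁B f∈J) f∈B
        J'⊆F : J [ t ↦ f ] ⊆ F
        J'⊆F h = [ (λ (z∈J , z≢t) → ∈∪⁅⁆-≢ (J⊆ z∈J) z≢t) , (λ { refl → f∈F }) ]′ (∈[↦]⁻ h)

  -- A co-independent I ⊆ F avoids some basis not containing t, when a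
  -- circuit of M − F passes through t: if t lies in the basis B that I
  -- avoids, exchange t for a pivot g ∉ F found on the circuit.
  avoiding-basis : I ⊆ F → Ind* I → IsCircuit Ind (∁ F) C → t ∈ C →
    Σ (Subset n) λ B → Basis B × t ∉ B × I ⊆ ∁ B
  avoiding-basis {I = I} {t = t} I⊆F (B , basB , I⊆∁B) circ t∈C with t ∈? B
  ... | no t∉B = B , basB , t∉B , I⊆∁B
  ... | yes t∈B with circuit-zeroSum circ t∈C
  ...   | Y , Y⊆C , zY , t∈Y with pivot basB t∈B Y zY t∈Y
  ...     | g , g∈Y , g∉B , span , t∈span =
    B [ t ↦ g ] , exchange basB g∉B span t∈span t∈B , y∉[↦] t∈B g∉B , ⊆∁[↦] I⊆∁B g∉I
    where
    g∉I : g ∉ I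
    g∉I g∈I = x∈∁p⇒x∉p (proj₁ circ (Y⊆C g∈Y)) (I⊆F g∈I)

  -- (⇐) If F spans t ∉ F in M*, no circuit of M − F passes through t:
  -- otherwise a maximum co-independent I ⊆ F extends by t.
  no-circuit-of-spans : t ∉ F → Spans Ind* F t → ∀ C → IsCircuit Ind (∁ F) C → t ∉ C
  no-circuit-of-spans {t = t} {F = F} t∉F spans C circ t∈C with rank* F
  ... | r , rank@((I , I⊆F , ind*I , refl) , _) with avoiding-basis I⊆F ind*I circ t∈C
  ...   | B , basB , t∉B , I⊆∁B =
    <⇒≱ (p⊂q⇒∣p∣<∣q∣ I⊂J) (proj₂ (spans r rank) (I ∪ ⁅ t ⁆) J⊆ ind*J)
    where
    I⊂J : I ⊂ I ∪ ⁅ t ⁆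
    I⊂J = p⊆p∪q _ , t , ∈∪⁅⁆ʳ , λ t∈I → t∉F (I⊆F t∈I)
    J⊆ : I ∪ ⁅ t ⁆ ⊆ F ∪ ⁅ t ⁆
    J⊆ = ∪⁅⁆-⊆ (λ h → ∈∪⁅⁆ˡ (I⊆F h)) ∈∪⁅⁆ʳ
    ind*J : Ind* (I ∪ ⁅ t ⁆)
    ind*J = B , basB , ∪⁅⁆-⊆ I⊆∁B (x∉p⇒x∈∁p t∉B)

∉-of-⊆∁ : F ⊆ ∁ p → t ∈ p → t ∉ F
∉-of-⊆∁ F⊆∁p t∈p t∈F = x∈∁p⇒x∉p (F⊆∁p t∈F) t∈p

-- The same F witnesses both problems; only the condition on T changes.
proposition1 : ∀ (m n : ℕ) (A : BinMatrix m n) (w : Fin n → ℕ) (T : Subset n) (k : ℕ) →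
    RSFS-yes (BinIndep A) w T k ⇔ SpaceCover-yes (Dual (BinIndep A)) w T k
proposition1 m n A w T k = mk⇔
  (λ (F , F⊆∁T , wF≤k , noCircuit) → F , F⊆∁T , wF≤k , λ t t∈T →
    spans-of-no-circuit (∉-of-⊆∁ F⊆∁T t∈T) (λ C circ → noCircuit C circ t t∈T))
  (λ (F , F⊆∁T , wF≤k , spans) → F , F⊆∁T , wF≤k , λ C circ t t∈T →
    no-circuit-of-spans (∉-of-⊆∁ F⊆∁T t∈T) (spans t t∈T) C circ)
  where open BinaryMatroid A
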